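{- Let $N$ be a level-$2$ network on $X$ containing a bad pendant blob with exactly three leaves, forming the chain $(a_1,a_2,a_3)$, and let $N'$ be the network obtained from $N$ by deleting the leaf $a_2$ (and suppressing the resulting degree-$2$ vertex). Then for all $x,y\in X\setminus\{a_2\}$, $d^{N'}_m(x,y)=d^N_m(x,y)$ if $\{x,y\}\ne\{a_1,a_3\}$, and $d^{N'}_m(a_1,a_3)=3$.
   Context: A network on a finite set $X$ with $|X|\ge 2$ is a finite, simple, connected, undirected, unweighted graph with at least two degree-$1$ vertices (leaves), leaves bijectively labelled by $X$, all other vertices of degree $3$; standing assumption: every cut-edge separates $X$ into two non-empty parts and distinct cut-edges induce distinct bipartitions. $d^N_m$ is the shortest-path distance (number of edges). A blob is a maximal $2$-connected subgraph with at least three vertices (level-$1$: a cycle; level-$2$: exactly two edges must be removed to obtain a tree); a level-$2$ network has all blobs of level at most $2$. A cut-edge is trivial if incident to a leaf; a blob is pendant if exactly one non-trivial cut-edge has exactly one endpoint in it. A chain is a maximal sequence of leaves whose neighbours form a path $v_1v_2\cdots$ in $N$. A bad pendant blob with three leaves is either a pendant level-$1$ blob incident to exactly four cut-edges (a cycle $w,v_1,v_2,v_3$ with $w$ on the non-trivial cut-edge and $v_i$ adjacent to leaf $a_i$), or a pendant level-$2$ blob with poles $p,q$ and main paths $p\,w\,q$ (with $w$ on the non-trivial cut-edge), the edge $pq$, and $p\,v_1v_2v_3\,q$ with $v_i$ adjacent to leaf $a_i$. -}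

module Defs where

open import Data.Nat using (ℕ; zero; suc; _≤_; _∸_; _<ᵇ_)
open import Data.Bool using (Bool; true; false; _∧_)
open import Data.Fin using (Fin; toℕ)
open import Data.Fin.Subset using (Subset; _∈_; _∉_; _⊆_; _─_; ⁅_⁆; ∣_∣)
open import Data.Vec using (lookup)
open import Data.List using (List; []; _∷_; length; filterᵇ; concatMap; map; allFin)
open import Data.List.Relation.Unary.Any using (Any)
open import Data.List.Relation.Unary.Unique.Propositional using (Unique)
open import Data.Product using (Σ; ∃; ∃-syntax; _×_; _,_)
open import Data.Sum using (_⊎_)
open import Relation.Nullary using (¬_)
open import Relation.Binary.PropositionalEquality using (_≡_; _≢_)
open import Function.Bundles using (_⇔_)

data Path {V : Set} (R : V → V → Set) : V → V → ℕ → Set where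
  here : ∀ {v} → Path R v v 0
  step : ∀ {u w v k} → R u w → Path R w v k → Path R u v (suc k)

Dist : {V : Set} → (V → V → Set) → V → V → ℕ → Set
Dist R u v k = Path R u v k × (∀ j → Path R u v j → k ≤ j)

Edge : ∀ {n} → (Fin n → Fin n → Bool) → Fin n → Fin n → Set
Edge E u v = E u v ≡ true

deg : ∀ {n} → (Fin n → Fin n → Bool) → Fin n → ℕ
deg {n} E v = length (filterᵇ (E v) (allFin n))

Minus : ∀ {n} → (Fin n → Fin n → Bool) → Fin n → Fin n → Fin n → Fin n → Set
Minus E u v w z = Edge E w z × ¬ (w ≡ u × z ≡ v) × ¬ (w ≡ v × z ≡ u)

CutEdge : ∀ {n} → (Fin n → Fin n → Bool) → Fin n → Fin n → Set
CutEdge E u v = Edge E u v × ¬ (∃[ k ] Path (Minus E u v) u v k)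

Side : ∀ {n} → (Fin n → Fin n → Bool) → Fin n → Fin n → Fin n → Set
Side E u v y = ∃[ k ] Path (Minus E u v) u y k

Leaf : ∀ {n} → (Fin n → Fin n → Bool) → Fin n → Set
Leaf E v = deg E v ≡ 1

NonTrivial : ∀ {n} → (Fin n → Fin n → Bool) → Fin n → Fin n → Set
NonTrivial E u v = ¬ Leaf E u × ¬ Leaf E v

record Network (n m : ℕ) : Set where
  field
    E         : Fin n → Fin n → Bool
    E-sym     : ∀ u v → E u v ≡ E v u
    E-irrefl  : ∀ v → E v v ≡ false
    connected : ∀ u v → ∃[ k ] Path (Edge E) u v k
    ℓ         : Fin m → Fin n
    ℓ-inj     : ∀ x y → ℓ x ≡ ℓ y → x ≡ y
    ℓ-leaf    : ∀ x → Leaf E (ℓ x)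
    leaf-ℓ    : ∀ v → Leaf E v → ∃[ x ] ℓ x ≡ v
    degrees   : ∀ v → deg E v ≡ 1 ⊎ deg E v ≡ 3
    X≥2       : 2 ≤ m
    cut-sep   : ∀ u v → CutEdge E u v →
                (∃[ x ] Side E u v (ℓ x)) × (∃[ x ] Side E v u (ℓ x))
    cut-dist  : ∀ u v u' v' → CutEdge E u v → CutEdge E u' v' →
                (∀ x → Side E u v (ℓ x) ⇔ Side E u' v' (ℓ x)) →
                u ≡ u' × v ≡ v'

-- Blobs (as vertex sets; a maximal 2-connected subgraph is induced)

Ind : ∀ {n} → (Fin n → Fin n → Bool) → Subset n → Fin n → Fin n → Set
Ind E S u v = u ∈ S × v ∈ S × Edge E u v

ConnectedOn : ∀ {n} → (Fin n → Fin n → Bool) → Subset n → Set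
ConnectedOn E S = ∀ u v → u ∈ S → v ∈ S → ∃[ k ] Path (Ind E S) u v k

TwoConn : ∀ {n} → (Fin n → Fin n → Bool) → Subset n → Set
TwoConn E S = ConnectedOn E S × (∀ x → x ∈ S → ConnectedOn E (S ─ ⁅ x ⁆))

IsBlob : ∀ {n} → (Fin n → Fin n → Bool) → Subset n → Set
IsBlob E S = 3 ≤ ∣ S ∣ × TwoConn E S ×
             (∀ S' → S ⊆ S' → TwoConn E S' → S' ⊆ S)

pairs : ∀ n → List (Fin n × Fin n)
pairs n = concatMap (λ u → map (λ v → (u , v)) (allFin n)) (allFin n)

edgesIn : ∀ {n} → (Fin n → Fin n → Bool) → Subset n → ℕ
edgesIn {n} E S =
  length (filterᵇ (λ { (u , v) → (toℕ u <ᵇ toℕ v) ∧ lookup S u ∧ lookup S v ∧ E u v })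
                  (pairs n))

-- level = number of edges to delete to obtain a (spanning) tree
level : ∀ {n} → (Fin n → Fin n → Bool) → Subset n → ℕ
level E S = suc (edgesIn E S) ∸ ∣ S ∣

Level2 : ∀ {n m} → Network n m → Set
Level2 N = ∀ S → IsBlob (Network.E N) S → level (Network.E N) S ≤ 2

PendEdge : ∀ {n} → (Fin n → Fin n → Bool) → Subset n → Fin n → Fin n → Set
PendEdge E S u v = CutEdge E u v × NonTrivial E u v × u ∈ S × v ∉ S

IsPendant : ∀ {n} → (Fin n → Fin n → Bool) → Subset n → Set
IsPendant E S = ∃[ u ] ∃[ v ] (PendEdge E S u v ×
                  (∀ u' v' → PendEdge E S u' v' → u' ≡ u × v' ≡ v))

_∈L_ : ∀ {n} → Fin n → List (Fin n) → Set
v ∈L xs = Any (v ≡_) xs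

VertexSet : ∀ {n} → Subset n → List (Fin n) → Set
VertexSet S xs = Unique xs × (∀ v → (v ∈ S) ⇔ (v ∈L xs))

BadPendantBlob3 : ∀ {n m} → Network n m → Fin m → Fin m → Fin m → Set
BadPendantBlob3 {n} N a₁ a₂ a₃ =
    -- level-1 case: cycle w v1 v2 v3
    (Σ (Subset n) λ S → ∃[ w ] ∃[ v₁ ] ∃[ v₂ ] ∃[ v₃ ]
       IsBlob E S × IsPendant E S ×
       VertexSet S (w ∷ v₁ ∷ v₂ ∷ v₃ ∷ []) ×
       Edge E w v₁ × Edge E v₁ v₂ × Edge E v₂ v₃ × Edge E v₃ w ×
       Edge E v₁ (ℓ a₁) × Edge E v₂ (ℓ a₂) × Edge E v₃ (ℓ a₃) ×
       (∃[ u ] PendEdge E S w u))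
  ⊎ -- level-2 case: poles p,q; paths p w q, p q, p v1 v2 v3 q
    (Σ (Subset n) λ S → ∃[ p ] ∃[ q ] ∃[ w ] ∃[ v₁ ] ∃[ v₂ ] ∃[ v₃ ]
       IsBlob E S × IsPendant E S ×
       VertexSet S (p ∷ q ∷ w ∷ v₁ ∷ v₂ ∷ v₃ ∷ []) ×
       Edge E p w × Edge E w q × Edge E p q ×
       Edge E p v₁ × Edge E v₁ v₂ × Edge E v₂ v₃ × Edge E v₃ q ×
       Edge E v₁ (ℓ a₁) × Edge E v₂ (ℓ a₂) × Edge E v₃ (ℓ a₃) ×
       (∃[ u ] PendEdge E S w u))
  where open Network N

-- N' : delete leaf l and suppress its (now degree-2) neighbour c.
-- Realised on the vertex set of N: the removed vertices l, c are simply
-- excluded from every edge; c's two remaining neighbours are joined.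

Kept : ∀ {n} → (Fin n → Fin n → Bool) → Fin n → Fin n → Set
Kept E l v = v ≢ l × ¬ Edge E v l

DelLeafAdj : ∀ {n} → (Fin n → Fin n → Bool) → Fin n → Fin n → Fin n → Set
DelLeafAdj E l x y =
  Kept E l x × Kept E l y ×
  (Edge E x y ⊎ (x ≢ y × ∃[ c ] (Edge E l c × Edge E x c × Edge E y c)))

-- Deleting a₂ replaces the path v₁ v₂ v₃ by a single edge v₁v₃. A walk of N′ using this shortcut
-- can be rerouted in N at no extra cost as long as it continues out of the chain region
-- {v₁,v₂,v₃,a₁,a₂,a₃}: it leaves through α (next to v₁) or β (next to v₃), and both are within
-- distance 2 of v₁ and of v₃ (α = β = w for a cycle; α = p, β = q for a level-2 blob).
-- Conversely, a walk of N through v₂ or a₂ enters and leaves via v₁ or v₃, and the shortcut does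
-- at least as well. So distances agree unless both ends lie in {a₁, a₃}; between a₁ and a₃ the
-- only route left is a₁ v₁ v₃ a₃.
module Submission where

open import Defs
open import Data.Nat using (ℕ; suc; _≤_; _<_; _+_; z≤n; s≤s)
open import Data.Nat.Properties using (≤-refl; ≤-trans; ≤-antisym; n≤1+n; suc-injective; +-monoˡ-≤; +-monoʳ-≤)
open import Data.Bool using (Bool)
open import Data.Bool.Properties using (T-≡)
open import Data.Fin using (Fin)
open import Data.Fin.Properties using (_≟_)
open import Data.List using ([]; _∷_; length; filterᵇ; allFin)
open import Data.List.Membership.Propositional using (_∈_)
open import Data.List.Membership.Propositional.Properties using (∈-allFin; ∈-filter⁺)
open import Data.List.Relation.Unary.Any using (here; there)
open import Data.List.Relation.Unary.All using ([]; _∷_)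
open import Data.List.Relation.Unary.AllPairs using ([]; _∷_)
open import Data.Product using (∃-syntax; _×_; _,_; proj₁; proj₂)
open import Data.Sum using (_⊎_; inj₁; inj₂; map₂)
open import Data.Empty using (⊥-elim)
open import Relation.Nullary using (¬_; yes; no)
open import Relation.Nullary.Decidable using (T?)
open import Relation.Binary.Definitions using (Symmetric)
open import Relation.Binary.PropositionalEquality using (_≡_; _≢_; refl; sym; trans; cong; subst)
open import Function using (_∘_)
open import Function.Bundles using (_⇔_; mk⇔; Equivalence)

module _ {A : Set} where

  remove-∈ : ∀ {a : A} {xs} → a ∈ xs →
             ∃[ ys ] length xs ≡ suc (length ys) × (∀ {z} → z ∈ xs → z ≡ a ⊎ z ∈ ys)
  remove-∈ {xs = x ∷ xs} (here refl) = xs , refl , λ { (here z≡x) → inj₁ z≡x ; (there z∈xs) → inj₂ z∈xs }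
  remove-∈ {xs = x ∷ xs} (there a∈xs) with remove-∈ a∈xs
  ... | ys , len , split = x ∷ ys , cong suc len , λ
    { (here z≡x) → inj₂ (here z≡x)
    ; (there z∈xs) → map₂ there (split z∈xs) }

  ∈-remaining : ∀ {a z : A} {xs ys} → (∀ {y} → y ∈ xs → y ≡ a ⊎ y ∈ ys) → z ∈ xs → z ≢ a → z ∈ ys
  ∈-remaining split z∈xs z≢a with split z∈xs
  ... | inj₁ z≡a = ⊥-elim (z≢a z≡a)
  ... | inj₂ z∈ys = z∈ys

  ∈-length≡1 : ∀ {a b : A} {xs} → length xs ≡ 1 → a ∈ xs → b ∈ xs → a ≡ b
  ∈-length≡1 {xs = _ ∷ []} _ (here refl) (here refl) = refl

  ∈-length≡3 : ∀ {a b c z : A} {xs} → length xs ≡ 3 → a ∈ xs → b ∈ xs → c ∈ xs →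
               a ≢ b → a ≢ c → b ≢ c → z ∈ xs → z ≡ a ⊎ z ≡ b ⊎ z ≡ c
  ∈-length≡3 {c = c} len a∈ b∈ c∈ a≢b a≢c b≢c z∈ with remove-∈ a∈
  ... | ys , len-ys , split-a with remove-∈ (∈-remaining split-a b∈ (a≢b ∘ sym))
  ... | zs , len-zs , split-b with split-a z∈
  ... | inj₁ z≡a = inj₁ z≡a
  ... | inj₂ z∈ys with split-b z∈ys
  ... | inj₁ z≡b = inj₂ (inj₁ z≡b)
  ... | inj₂ z∈zs = inj₂ (inj₂ (∈-length≡1 zs-singleton z∈zs c∈zs))
    where
    zs-singleton : length zs ≡ 1
    zs-singleton = suc-injective (trans (sym len-zs) (suc-injective (trans (sym len-ys) len)))

    c∈zs : c ∈ zs
    c∈zs = ∈-remaining split-b (∈-remaining split-a c∈ (a≢c ∘ sym)) (b≢c ∘ sym)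

module _ {n} (E : Fin n → Fin n → Bool) where

  ∈-neighbours : ∀ {v z} → Edge E v z → z ∈ filterᵇ (E v) (allFin n)
  ∈-neighbours {v} {z} e = ∈-filter⁺ (T? ∘ E v) (∈-allFin z) (Equivalence.from T-≡ e)

  Edge-sym : (∀ u v → E u v ≡ E v u) → Symmetric (Edge E)
  Edge-sym E-sym {u} {v} e = trans (E-sym v u) e

  DelLeafAdj-sym : (∀ u v → E u v ≡ E v u) → ∀ l → Symmetric (DelLeafAdj E l)
  DelLeafAdj-sym E-sym l (x-kept , y-kept , inj₁ e) = y-kept , x-kept , inj₁ (Edge-sym E-sym e)
  DelLeafAdj-sym E-sym l (x-kept , y-kept , inj₂ (x≢y , c , l-c , x-c , y-c)) =
    y-kept , x-kept , inj₂ (x≢y ∘ sym , c , l-c , y-c , x-c)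

  leaf-neighbour-unique : ∀ {v a b} → Leaf E v → Edge E v a → Edge E v b → a ≡ b
  leaf-neighbour-unique leaf v-a v-b = ∈-length≡1 leaf (∈-neighbours v-a) (∈-neighbours v-b)

  two-neighbours⇒¬Leaf : ∀ {v a b} → Edge E v a → Edge E v b → a ≢ b → ¬ Leaf E v
  two-neighbours⇒¬Leaf v-a v-b a≢b leaf = a≢b (leaf-neighbour-unique leaf v-a v-b)

  degree3-neighbours : ∀ {v a b c d} → deg E v ≡ 3 →
                       Edge E v a → Edge E v b → Edge E v c → a ≢ b → a ≢ c → b ≢ c →
                       Edge E v d → d ≡ a ⊎ d ≡ b ⊎ d ≡ c
  degree3-neighbours deg3 v-a v-b v-c a≢b a≢c b≢c v-d =
    ∈-length≡3 deg3 (∈-neighbours v-a) (∈-neighbours v-b) (∈-neighbours v-c)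
               a≢b a≢c b≢c (∈-neighbours v-d)

module _ {V : Set} {R : V → V → Set} where

  _++ᵖ_ : ∀ {u v w i j} → Path R u v i → Path R v w j → Path R u w (i + j)
  here ++ᵖ q = q
  step r p ++ᵖ q = step r (p ++ᵖ q)

  _∷ʳᵖ_ : ∀ {u v w k} → Path R u v k → R v w → Path R u w (suc k)
  here ∷ʳᵖ r = step r here
  step r′ p ∷ʳᵖ r = step r′ (p ∷ʳᵖ r)

  reverse : Symmetric R → ∀ {u v k} → Path R u v k → Path R v u k
  reverse R-sym here = here
  reverse R-sym (step r p) = reverse R-sym p ∷ʳᵖ R-sym r

Within : {V : Set} → (V → V → Set) → V → V → ℕ → Set
Within R u v j = ∃[ i ] i ≤ j × Path R u v i

Shortens : {V : Set} → (V → V → Set) → (V → V → Set) → V → V → Set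
Shortens R S u v = ∀ {j} → Path R u v j → Within S u v j

SameDistance : {V : Set} → (V → V → Set) → (V → V → Set) → V → V → Set
SameDistance R S u v = Shortens R S u v × Shortens S R u v

module _ {V : Set} {R : V → V → Set} where

  edge-within : ∀ {u v j} → R u v → Within R u v (suc j)
  edge-within r = 1 , s≤s z≤n , step r here

  Within-≤ : ∀ {u v i j} → i ≤ j → Within R u v i → Within R u v j
  Within-≤ i≤j (k , k≤i , p) = k , ≤-trans k≤i i≤j , p

  Within-++ : ∀ {u v w i j} → Within R u v i → Within R v w j → Within R u w (i + j)
  Within-++ {i = i} (k , k≤i , p) (l , l≤j , q) =
    k + l , ≤-trans (+-monoˡ-≤ l k≤i) (+-monoʳ-≤ i l≤j) , p ++ᵖ q

module _ {V : Set} {R S : V → V → Set} where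

  SameDistance-refl : ∀ {u} → SameDistance R S u u
  SameDistance-refl = (λ _ → 0 , z≤n , here) , (λ _ → 0 , z≤n , here)

  SameDistance-sym : Symmetric R → Symmetric S → ∀ {u v} → SameDistance R S u v → SameDistance R S v u
  SameDistance-sym R-sym S-sym (R⇒S , S⇒R) = reversed R-sym S-sym R⇒S , reversed S-sym R-sym S⇒R
    where
    reversed : ∀ {P Q} → Symmetric P → Symmetric Q → ∀ {u v} → Shortens P Q u v → Shortens P Q v u
    reversed P-sym Q-sym P⇒Q p with P⇒Q (reverse P-sym p)
    ... | i , i≤j , q = i , i≤j , reverse Q-sym q

  SameDistance⇒Dist⇔ : ∀ {u v} → SameDistance R S u v → ∀ k → Dist R u v k ⇔ Dist S u v k
  SameDistance⇒Dist⇔ {u} {v} (R⇒S , S⇒R) k = mk⇔ (transfer R⇒S S⇒R) (transfer S⇒R R⇒S)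
    where
    transfer : ∀ {P Q} → Shortens P Q u v → Shortens Q P u v → Dist P u v k → Dist Q u v k
    transfer P⇒Q Q⇒P (p , p-min) with P⇒Q p
    ... | i , i≤k , q = subst (Path _ u v) (≤-antisym i≤k (q-min i q)) q , q-min
      where
      q-min : ∀ j → Path _ u v j → k ≤ j
      q-min _ q′ with Q⇒P q′
      ... | i′ , i′≤j , p′ = ≤-trans (p-min _ p′) i′≤j

  shortens-stepwise : ∀ {t} → (∀ {x y} → R x y → S x y ⊎ (∀ {j} → Path S y t j → Within S x t (suc j))) →
                      ∀ {u} → Shortens R S u t
  shortens-stepwise replace here = 0 , z≤n , here
  shortens-stepwise replace (step r p) with shortens-stepwise replace p | replace r
  ... | i , i≤j , q | inj₁ s = suc i , s≤s i≤j , step s q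
  ... | i , i≤j , q | inj₂ detour = Within-≤ (s≤s i≤j) (detour q)

module _ {V : Set} {R : V → V → Set} {Z X : V → Set}
         (closed : ∀ {z z′} → Z z → R z z′ → Z z′ ⊎ X z′) where

  exit-through : ∀ {u t j} → Z u → ¬ Z t → Path R u t j → ∃[ e ] X e × ∃[ i ] i < j × Path R e t i
  exit-through u∈Z t∉Z here = ⊥-elim (t∉Z u∈Z)
  exit-through u∈Z t∉Z (step r p) with closed u∈Z r
  ... | inj₂ x = _ , x , _ , ≤-refl , p
  ... | inj₁ w∈Z with exit-through w∈Z t∉Z p
  ...   | e , x , i , i<j , q = e , x , i , ≤-trans i<j (n≤1+n _) , q

record Chain {n} (E : Fin n → Fin n → Bool) (l₁ l₂ l₃ : Fin n) : Set where
  field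
    E-sym : ∀ u v → E u v ≡ E v u
    v₁ v₂ v₃ α β : Fin n
    l₁-v₁ : Edge E l₁ v₁
    l₂-v₂ : Edge E l₂ v₂
    l₃-v₃ : Edge E l₃ v₃
    l₁-leaf : Leaf E l₁
    l₂-leaf : Leaf E l₂
    l₃-leaf : Leaf E l₃
    v₁-α : Edge E v₁ α
    v₁-v₂ : Edge E v₁ v₂
    v₃-v₂ : Edge E v₃ v₂
    v₃-β : Edge E v₃ β
    v₁-neighbours : ∀ {z} → Edge E v₁ z → z ≡ α ⊎ z ≡ v₂ ⊎ z ≡ l₁
    v₂-neighbours : ∀ {z} → Edge E v₂ z → z ≡ v₁ ⊎ z ≡ v₃ ⊎ z ≡ l₂
    v₃-neighbours : ∀ {z} → Edge E v₃ z → z ≡ v₂ ⊎ z ≡ β ⊎ z ≡ l₃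
    v₁≢v₂ : v₁ ≢ v₂
    v₃≢v₂ : v₃ ≢ v₂
    v₁≢v₃ : v₁ ≢ v₃
    leaf≢v₁ : ∀ {z} → Leaf E z → z ≢ v₁
    leaf≢v₂ : ∀ {z} → Leaf E z → z ≢ v₂
    leaf≢v₃ : ∀ {z} → Leaf E z → z ≢ v₃
    v₁⇝β : Within (Edge E) v₁ β 2
    v₃⇝α : Within (Edge E) v₃ α 2

module ChainProperties {n} {E : Fin n → Fin n → Bool} {l₁ l₂ l₃ : Fin n} (c : Chain E l₁ l₂ l₃) where
  open Chain c

  G G′ : Fin n → Fin n → Set
  G = Edge E
  G′ = DelLeafAdj E l₂

  G-sym : Symmetric G
  G-sym = Edge-sym E E-sym

  G′-sym : Symmetric G′
  G′-sym = DelLeafAdj-sym E E-sym l₂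

  kept : ∀ {u} → u ≢ l₂ → u ≢ v₂ → Kept E l₂ u
  kept u≢l₂ u≢v₂ = u≢l₂ , λ u-l₂ → u≢v₂ (leaf-neighbour-unique E l₂-leaf (G-sym u-l₂) l₂-v₂)

  kept⇒≢v₂ : ∀ {u} → Kept E l₂ u → u ≢ v₂
  kept⇒≢v₂ (_ , ¬u-l₂) refl = ¬u-l₂ (G-sym l₂-v₂)

  v₁-kept : Kept E l₂ v₁
  v₁-kept = kept (leaf≢v₁ l₂-leaf ∘ sym) v₁≢v₂

  v₃-kept : Kept E l₂ v₃
  v₃-kept = kept (leaf≢v₃ l₂-leaf ∘ sym) v₃≢v₂

  l₁-kept : Kept E l₂ l₁
  l₁-kept = kept (λ l₁≡l₂ → v₁≢v₂ (leaf-neighbour-unique E l₂-leaf (subst (λ l → G l v₁) l₁≡l₂ l₁-v₁) l₂-v₂))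
                 (leaf≢v₂ l₁-leaf)

  l₃-kept : Kept E l₂ l₃
  l₃-kept = kept (λ l₃≡l₂ → v₃≢v₂ (leaf-neighbour-unique E l₂-leaf (subst (λ l → G l v₃) l₃≡l₂ l₃-v₃) l₂-v₂))
                 (leaf≢v₂ l₃-leaf)

  shortcut₁₃ : G′ v₁ v₃
  shortcut₁₃ = v₁-kept , v₃-kept , inj₂ (v₁≢v₃ , v₂ , l₂-v₂ , v₁-v₂ , v₃-v₂)

  shortcut₃₁ : G′ v₃ v₁
  shortcut₃₁ = G′-sym shortcut₁₃

  kept-neighbour-of-v₂ : ∀ {u} → Kept E l₂ u → G u v₂ → u ≡ v₁ ⊎ u ≡ v₃
  kept-neighbour-of-v₂ (u≢l₂ , _) u-v₂ with v₂-neighbours (G-sym u-v₂)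
  ... | inj₁ u≡v₁ = inj₁ u≡v₁
  ... | inj₂ (inj₁ u≡v₃) = inj₂ u≡v₃
  ... | inj₂ (inj₂ u≡l₂) = ⊥-elim (u≢l₂ u≡l₂)

  G′-step : ∀ {x y} → G′ x y → G x y ⊎ (x ≡ v₁ × y ≡ v₃) ⊎ (x ≡ v₃ × y ≡ v₁)
  G′-step (_ , _ , inj₁ e) = inj₁ e
  G′-step (x-kept , y-kept , inj₂ (x≢y , c , l₂-c , x-c , y-c))
    with leaf-neighbour-unique E l₂-leaf l₂-c l₂-v₂
  ... | refl with kept-neighbour-of-v₂ x-kept x-c | kept-neighbour-of-v₂ y-kept y-c
  ... | inj₁ refl | inj₁ refl = ⊥-elim (x≢y refl)
  ... | inj₁ refl | inj₂ refl = inj₂ (inj₁ (refl , refl))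
  ... | inj₂ refl | inj₁ refl = inj₂ (inj₂ (refl , refl))
  ... | inj₂ refl | inj₂ refl = ⊥-elim (x≢y refl)

  Region : Fin n → Set
  Region z = z ∈ v₁ ∷ v₂ ∷ v₃ ∷ l₁ ∷ l₂ ∷ l₃ ∷ []

  region-exits : ∀ {z z′} → Region z → G z z′ → Region z′ ⊎ z′ ≡ α ⊎ z′ ≡ β
  region-exits (here refl) e with v₁-neighbours e
  ... | inj₁ z′≡α = inj₂ (inj₁ z′≡α)
  ... | inj₂ (inj₁ z′≡v₂) = inj₁ (there (here z′≡v₂))
  ... | inj₂ (inj₂ z′≡l₁) = inj₁ (there (there (there (here z′≡l₁))))
  region-exits (there (here refl)) e with v₂-neighbours e
  ... | inj₁ z′≡v₁ = inj₁ (here z′≡v₁)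
  ... | inj₂ (inj₁ z′≡v₃) = inj₁ (there (there (here z′≡v₃)))
  ... | inj₂ (inj₂ z′≡l₂) = inj₁ (there (there (there (there (here z′≡l₂)))))
  region-exits (there (there (here refl))) e with v₃-neighbours e
  ... | inj₁ z′≡v₂ = inj₁ (there (here z′≡v₂))
  ... | inj₂ (inj₁ z′≡β) = inj₂ (inj₂ z′≡β)
  ... | inj₂ (inj₂ z′≡l₃) = inj₁ (there (there (there (there (there (here z′≡l₃))))))
  region-exits (there (there (there (here refl)))) e =
    inj₁ (here (leaf-neighbour-unique E l₁-leaf e l₁-v₁))
  region-exits (there (there (there (there (here refl))))) e =
    inj₁ (there (here (leaf-neighbour-unique E l₂-leaf e l₂-v₂)))
  region-exits (there (there (there (there (there (here refl)))))) e =
    inj₁ (there (there (here (leaf-neighbour-unique E l₃-leaf e l₃-v₃))))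

  module _ {t} (t∉Region : ¬ Region t) where

    detour : ∀ {x y j} → Within G x α 2 → Within G x β 2 → Region y → Path G y t j → Within G x t (suc j)
    detour x⇝α x⇝β y∈Region p with exit-through region-exits y∈Region t∉Region p
    ... | _ , inj₁ refl , i , i<j , q = Within-≤ (s≤s i<j) (Within-++ x⇝α (i , ≤-refl , q))
    ... | _ , inj₂ refl , i , i<j , q = Within-≤ (s≤s i<j) (Within-++ x⇝β (i , ≤-refl , q))

    G′-shortens-to-G : ∀ {u} → Shortens G′ G u t
    G′-shortens-to-G = shortens-stepwise replace
      where
      replace : ∀ {x y} → G′ x y → G x y ⊎ (∀ {j} → Path G y t j → Within G x t (suc j))
      replace r with G′-step r
      ... | inj₁ e = inj₁ e
      ... | inj₂ (inj₁ (refl , refl)) = inj₂ (detour (edge-within v₁-α) v₁⇝β (there (there (here refl))))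
      ... | inj₂ (inj₂ (refl , refl)) = inj₂ (detour v₃⇝α (edge-within v₃-β) (here refl))

  module _ {t} (t-kept : Kept E l₂ t) where

    -- A walk that reaches v₂ or l₂ must come back out through v₁ or v₃, so from there the rest
    -- of the walk is available to both v₁ and v₃ (one of them via the shortcut).
    Suppressed⇝ : ℕ → Set
    Suppressed⇝ j = Within G′ v₁ t j × Within G′ v₃ t j

    Shortened : Fin n → ℕ → Set
    Shortened u j = (Kept E l₂ u → Within G′ u t j) × (u ≡ v₂ ⊎ u ≡ l₂ → Suppressed⇝ j)

    Suppressed⇝-suc : ∀ {j} → Suppressed⇝ j → Suppressed⇝ (suc j)
    Suppressed⇝-suc (v₁⇝t , v₃⇝t) = Within-≤ (n≤1+n _) v₁⇝t , Within-≤ (n≤1+n _) v₃⇝t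

    step-from-v₂ : ∀ {w j} → G v₂ w → Shortened w j → Suppressed⇝ (suc j)
    step-from-v₂ v₂-w (from-kept , from-suppressed) with v₂-neighbours v₂-w
    ... | inj₁ refl with from-kept v₁-kept
    ...   | i , i≤j , q = (i , ≤-trans i≤j (n≤1+n _) , q) , (suc i , s≤s i≤j , step shortcut₃₁ q)
    step-from-v₂ v₂-w (from-kept , _) | inj₂ (inj₁ refl) with from-kept v₃-kept
    ...   | i , i≤j , q = (suc i , s≤s i≤j , step shortcut₁₃ q) , (i , ≤-trans i≤j (n≤1+n _) , q)
    step-from-v₂ v₂-w (_ , from-suppressed) | inj₂ (inj₂ refl) =
      Suppressed⇝-suc (from-suppressed (inj₂ refl))

    step-from-l₂ : ∀ {w j} → G l₂ w → Shortened w j → Suppressed⇝ (suc j)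
    step-from-l₂ l₂-w (_ , from-suppressed) with leaf-neighbour-unique E l₂-leaf l₂-w l₂-v₂
    ... | refl = Suppressed⇝-suc (from-suppressed (inj₁ refl))

    step-from-kept : ∀ {u w j} → Kept E l₂ u → G u w → Shortened w j → Within G′ u t (suc j)
    step-from-kept {u} {w} u-kept u-w (from-kept , from-suppressed) with w ≟ l₂ | w ≟ v₂
    ... | yes refl | _ = ⊥-elim (proj₂ u-kept u-w)
    ... | no _ | yes refl with kept-neighbour-of-v₂ u-kept u-w | from-suppressed (inj₁ refl)
    ...   | inj₁ refl | v₁⇝t , _ = Within-≤ (n≤1+n _) v₁⇝t
    ...   | inj₂ refl | _ , v₃⇝t = Within-≤ (n≤1+n _) v₃⇝t
    step-from-kept u-kept u-w (from-kept , _) | no w≢l₂ | no w≢v₂ with from-kept (kept w≢l₂ w≢v₂)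
    ...   | i , i≤j , q = suc i , s≤s i≤j , step (u-kept , kept w≢l₂ w≢v₂ , inj₁ u-w) q

    shortened : ∀ {u j} → Path G u t j → Shortened u j
    shortened here = (λ _ → 0 , z≤n , here) , λ
      { (inj₁ t≡v₂) → ⊥-elim (kept⇒≢v₂ t-kept t≡v₂)
      ; (inj₂ t≡l₂) → ⊥-elim (proj₁ t-kept t≡l₂) }
    shortened (step r p) = (λ u-kept → step-from-kept u-kept r (shortened p)) , λ
      { (inj₁ refl) → step-from-v₂ r (shortened p)
      ; (inj₂ refl) → step-from-l₂ r (shortened p) }

    G-shortens-to-G′ : ∀ {u} → Kept E l₂ u → Shortens G G′ u t
    G-shortens-to-G′ u-kept p = proj₁ (shortened p) u-kept

  G′-from-l₁ : ∀ {w} → G′ l₁ w → w ≡ v₁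
  G′-from-l₁ r with G′-step r
  ... | inj₁ e = leaf-neighbour-unique E l₁-leaf e l₁-v₁
  ... | inj₂ (inj₁ (l₁≡v₁ , _)) = ⊥-elim (leaf≢v₁ l₁-leaf l₁≡v₁)
  ... | inj₂ (inj₂ (l₁≡v₃ , _)) = ⊥-elim (leaf≢v₃ l₁-leaf l₁≡v₃)

  ¬G′-v₁-l₃ : ¬ G′ v₁ l₃
  ¬G′-v₁-l₃ r with G′-step r
  ... | inj₁ e = v₁≢v₃ (leaf-neighbour-unique E l₃-leaf (G-sym e) l₃-v₃)
  ... | inj₂ (inj₁ (_ , l₃≡v₃)) = leaf≢v₃ l₃-leaf l₃≡v₃
  ... | inj₂ (inj₂ (v₁≡v₃ , _)) = v₁≢v₃ v₁≡v₃

  Dist-l₁-l₃ : Dist G′ l₁ l₃ 3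
  Dist-l₁-l₃ = step (l₁-kept , v₁-kept , inj₁ l₁-v₁)
                 (step shortcut₁₃ (step (v₃-kept , l₃-kept , inj₁ (G-sym l₃-v₃)) here))
             , λ _ → three≤ refl
    where
    l₁≢l₃ : l₁ ≢ l₃
    l₁≢l₃ l₁≡l₃ = v₁≢v₃ (leaf-neighbour-unique E l₃-leaf (subst (λ l → G l v₁) l₁≡l₃ l₁-v₁) l₃-v₃)

    three≤ : ∀ {u j} → u ≡ l₁ → Path G′ u l₃ j → 3 ≤ j
    three≤ u≡l₁ here = ⊥-elim (l₁≢l₃ (sym u≡l₁))
    three≤ refl (step r here) = ⊥-elim (leaf≢v₁ l₃-leaf (G′-from-l₁ r))
    three≤ refl (step r (step r′ here)) with G′-from-l₁ r
    ... | refl = ⊥-elim (¬G′-v₁-l₃ r′)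
    three≤ refl (step _ (step _ (step _ _))) = s≤s (s≤s (s≤s z≤n))

module _ {n m} (N : Network n m) {a₁ a₂ a₃ : Fin m} where
  open Network N

  degree3 : ∀ {v a b} → Edge E v a → Edge E v b → a ≢ b → deg E v ≡ 3
  degree3 {v} v-a v-b a≢b with degrees v
  ... | inj₁ leaf = ⊥-elim (two-neighbours⇒¬Leaf E v-a v-b a≢b leaf)
  ... | inj₂ deg3 = deg3

  leaf≢non-leaf : ∀ {z x} → Leaf E z → ¬ Leaf E x → z ≢ x
  leaf≢non-leaf leaf non-leaf refl = non-leaf leaf

  chain : ∀ {v₁ v₂ v₃ α β} →
          Edge E v₁ α → Edge E v₁ v₂ → Edge E v₂ v₃ → Edge E v₃ β →
          Edge E v₁ (ℓ a₁) → Edge E v₂ (ℓ a₂) → Edge E v₃ (ℓ a₃) →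
          Within (Edge E) v₁ β 2 → Within (Edge E) v₃ α 2 →
          v₁ ≢ v₂ → v₂ ≢ v₃ → v₁ ≢ v₃ → α ≢ v₂ → β ≢ v₂ → ¬ Leaf E α → ¬ Leaf E β →
          Chain E (ℓ a₁) (ℓ a₂) (ℓ a₃)
  chain {v₁} {v₂} {v₃} {α} {β} v₁-α v₁-v₂ v₂-v₃ v₃-β v₁-l₁ v₂-l₂ v₃-l₃ v₁⇝β v₃⇝α
        v₁≢v₂ v₂≢v₃ v₁≢v₃ α≢v₂ β≢v₂ α-non-leaf β-non-leaf = record
    { E-sym = E-sym ; v₁ = v₁ ; v₂ = v₂ ; v₃ = v₃ ; α = α ; β = β
    ; l₁-v₁ = flip v₁-l₁ ; l₂-v₂ = flip v₂-l₂ ; l₃-v₃ = flip v₃-l₃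
    ; l₁-leaf = ℓ-leaf a₁ ; l₂-leaf = ℓ-leaf a₂ ; l₃-leaf = ℓ-leaf a₃
    ; v₁-α = v₁-α ; v₁-v₂ = v₁-v₂ ; v₃-v₂ = flip v₂-v₃ ; v₃-β = v₃-β
    ; v₁-neighbours = degree3-neighbours E (degree3 v₁-α v₁-v₂ α≢v₂) v₁-α v₁-v₂ v₁-l₁
                        α≢v₂ (leaf≢non-leaf (ℓ-leaf a₁) α-non-leaf ∘ sym) (leaf≢v₂ (ℓ-leaf a₁) ∘ sym)
    ; v₂-neighbours = degree3-neighbours E (degree3 (flip v₁-v₂) v₂-v₃ v₁≢v₃) (flip v₁-v₂) v₂-v₃ v₂-l₂
                        v₁≢v₃ (leaf≢v₁ (ℓ-leaf a₂) ∘ sym) (leaf≢v₃ (ℓ-leaf a₂) ∘ sym)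
    ; v₃-neighbours = degree3-neighbours E (degree3 (flip v₂-v₃) v₃-β (β≢v₂ ∘ sym)) (flip v₂-v₃) v₃-β v₃-l₃
                        (β≢v₂ ∘ sym) (leaf≢v₂ (ℓ-leaf a₃) ∘ sym) (leaf≢non-leaf (ℓ-leaf a₃) β-non-leaf ∘ sym)
    ; v₁≢v₂ = v₁≢v₂ ; v₃≢v₂ = v₂≢v₃ ∘ sym ; v₁≢v₃ = v₁≢v₃
    ; leaf≢v₁ = leaf≢v₁ ; leaf≢v₂ = leaf≢v₂ ; leaf≢v₃ = leaf≢v₃
    ; v₁⇝β = v₁⇝β ; v₃⇝α = v₃⇝α }
    where
    flip : Symmetric (Edge E)
    flip = Edge-sym E E-sym

    leaf≢v₁ : ∀ {z} → Leaf E z → z ≢ v₁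
    leaf≢v₁ leaf refl = two-neighbours⇒¬Leaf E v₁-α v₁-v₂ α≢v₂ leaf

    leaf≢v₂ : ∀ {z} → Leaf E z → z ≢ v₂
    leaf≢v₂ leaf refl = two-neighbours⇒¬Leaf E (flip v₁-v₂) v₂-v₃ v₁≢v₃ leaf

    leaf≢v₃ : ∀ {z} → Leaf E z → z ≢ v₃
    leaf≢v₃ leaf refl = two-neighbours⇒¬Leaf E (flip v₂-v₃) v₃-β (β≢v₂ ∘ sym) leaf

  badPendantBlob⇒Chain : BadPendantBlob3 N a₁ a₂ a₃ → Chain E (ℓ a₁) (ℓ a₂) (ℓ a₃)
  badPendantBlob⇒Chain (inj₁ (_ , w , v₁ , v₂ , v₃ , _ , _ ,
      (((_ ∷ w≢v₂ ∷ _ ∷ []) ∷ (v₁≢v₂ ∷ v₁≢v₃ ∷ []) ∷ (v₂≢v₃ ∷ []) ∷ [] ∷ []) , _) ,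
      w-v₁ , v₁-v₂ , v₂-v₃ , v₃-w , v₁-l₁ , v₂-l₂ , v₃-l₃ , _)) =
    chain (flip w-v₁) v₁-v₂ v₂-v₃ v₃-w v₁-l₁ v₂-l₂ v₃-l₃ (edge-within (flip w-v₁)) (edge-within v₃-w)
          v₁≢v₂ v₂≢v₃ v₁≢v₃ w≢v₂ w≢v₂ w-non-leaf w-non-leaf
    where
    flip : Symmetric (Edge E)
    flip = Edge-sym E E-sym

    w-non-leaf : ¬ Leaf E w
    w-non-leaf = two-neighbours⇒¬Leaf E w-v₁ (flip v₃-w) v₁≢v₃
  badPendantBlob⇒Chain (inj₂ (_ , p , q , w , v₁ , v₂ , v₃ , _ , _ ,
      (((_ ∷ p≢w ∷ _ ∷ p≢v₂ ∷ _ ∷ []) ∷ (q≢w ∷ _ ∷ q≢v₂ ∷ _ ∷ []) ∷ _ ∷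
        (v₁≢v₂ ∷ v₁≢v₃ ∷ []) ∷ (v₂≢v₃ ∷ []) ∷ [] ∷ []) , _) ,
      p-w , w-q , p-q , p-v₁ , v₁-v₂ , v₂-v₃ , v₃-q , v₁-l₁ , v₂-l₂ , v₃-l₃ , _)) =
    chain (flip p-v₁) v₁-v₂ v₂-v₃ v₃-q v₁-l₁ v₂-l₂ v₃-l₃
          (2 , ≤-refl , step (flip p-v₁) (step p-q here)) (2 , ≤-refl , step v₃-q (step (flip p-q) here))
          v₁≢v₂ v₂≢v₃ v₁≢v₃ p≢v₂ q≢v₂ p-non-leaf q-non-leaf
    where
    flip : Symmetric (Edge E)
    flip = Edge-sym E E-sym

    p-non-leaf : ¬ Leaf E p
    p-non-leaf = two-neighbours⇒¬Leaf E p-w p-q (q≢w ∘ sym)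

    q-non-leaf : ¬ Leaf E q
    q-non-leaf = two-neighbours⇒¬Leaf E (flip w-q) (flip p-q) (p≢w ∘ sym)

  module LabelDistances (c : Chain E (ℓ a₁) (ℓ a₂) (ℓ a₃)) where
    open Chain c using (leaf≢v₁; leaf≢v₂; leaf≢v₃)
    open ChainProperties c

    label-kept : ∀ {x} → x ≢ a₂ → Kept E (ℓ a₂) (ℓ x)
    label-kept {x} x≢a₂ = kept (x≢a₂ ∘ ℓ-inj x a₂) (leaf≢v₂ (ℓ-leaf x))

    label∉Region : ∀ {y} → y ≢ a₁ → y ≢ a₂ → y ≢ a₃ → ¬ Region (ℓ y)
    label∉Region {y} _ _ _ (here ℓy≡v₁) = leaf≢v₁ (ℓ-leaf y) ℓy≡v₁
    label∉Region {y} _ _ _ (there (here ℓy≡v₂)) = leaf≢v₂ (ℓ-leaf y) ℓy≡v₂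
    label∉Region {y} _ _ _ (there (there (here ℓy≡v₃))) = leaf≢v₃ (ℓ-leaf y) ℓy≡v₃
    label∉Region {y} y≢a₁ _ _ (there (there (there (here ℓy≡l₁)))) = y≢a₁ (ℓ-inj y a₁ ℓy≡l₁)
    label∉Region {y} _ y≢a₂ _ (there (there (there (there (here ℓy≡l₂))))) = y≢a₂ (ℓ-inj y a₂ ℓy≡l₂)
    label∉Region {y} _ _ y≢a₃ (there (there (there (there (there (here ℓy≡l₃)))))) = y≢a₃ (ℓ-inj y a₃ ℓy≡l₃)

    towards-outer-label : ∀ {x y} → x ≢ a₂ → y ≢ a₁ → y ≢ a₂ → y ≢ a₃ → SameDistance G′ G (ℓ x) (ℓ y)
    towards-outer-label x≢a₂ y≢a₁ y≢a₂ y≢a₃ =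
      G′-shortens-to-G (label∉Region y≢a₁ y≢a₂ y≢a₃) , G-shortens-to-G′ (label-kept y≢a₂) (label-kept x≢a₂)

    equal-or-outer : ∀ {x y} → ¬ ((x ≡ a₁ × y ≡ a₃) ⊎ (x ≡ a₃ × y ≡ a₁)) →
                     x ≡ y ⊎ (y ≢ a₁ × y ≢ a₃) ⊎ (x ≢ a₁ × x ≢ a₃)
    equal-or-outer {x} {y} ¬pair with y ≟ a₁ | y ≟ a₃ | x ≟ a₁ | x ≟ a₃
    ... | no y≢a₁ | no y≢a₃ | _ | _ = inj₂ (inj₁ (y≢a₁ , y≢a₃))
    ... | _ | _ | no x≢a₁ | no x≢a₃ = inj₂ (inj₂ (x≢a₁ , x≢a₃))
    ... | yes refl | _ | yes refl | _ = inj₁ refl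
    ... | yes refl | _ | no _ | yes refl = ⊥-elim (¬pair (inj₂ (refl , refl)))
    ... | no _ | yes refl | yes refl | _ = ⊥-elim (¬pair (inj₁ (refl , refl)))
    ... | no _ | yes refl | no _ | yes refl = inj₁ refl

    labels-same-distance : ∀ {x y} → x ≢ a₂ → y ≢ a₂ → ¬ ((x ≡ a₁ × y ≡ a₃) ⊎ (x ≡ a₃ × y ≡ a₁)) →
                           SameDistance G′ G (ℓ x) (ℓ y)
    labels-same-distance x≢a₂ y≢a₂ ¬pair with equal-or-outer ¬pair
    ... | inj₁ refl = SameDistance-refl
    ... | inj₂ (inj₁ (y≢a₁ , y≢a₃)) = towards-outer-label x≢a₂ y≢a₁ y≢a₂ y≢a₃
    ... | inj₂ (inj₂ (x≢a₁ , x≢a₃)) = SameDistance-sym G′-sym G-sym (towards-outer-label y≢a₂ x≢a₁ x≢a₂ x≢a₃)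

lemma9 : ∀ {n m} (N : Network n m) (a₁ a₂ a₃ : Fin m) →
    Level2 N → BadPendantBlob3 N a₁ a₂ a₃ →
    (∀ x y → x ≢ a₂ → y ≢ a₂ → ¬ ((x ≡ a₁ × y ≡ a₃) ⊎ (x ≡ a₃ × y ≡ a₁)) →
      ∀ k → Dist (DelLeafAdj (Network.E N) (Network.ℓ N a₂)) (Network.ℓ N x) (Network.ℓ N y) k
          ⇔ Dist (Edge (Network.E N)) (Network.ℓ N x) (Network.ℓ N y) k)
    × Dist (DelLeafAdj (Network.E N) (Network.ℓ N a₂)) (Network.ℓ N a₁) (Network.ℓ N a₃) 3
-- Only the local shape of the blob matters.
lemma9 N a₁ a₂ a₃ _ bad =
  (λ x y x≢a₂ y≢a₂ ¬pair → SameDistance⇒Dist⇔ (labels-same-distance x≢a₂ y≢a₂ ¬pair)) , Dist-l₁-l₃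
  where
  open ChainProperties (badPendantBlob⇒Chain N bad) using (Dist-l₁-l₃)
  open LabelDistances N (badPendantBlob⇒Chain N bad)
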